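{- Let $n\ge 1$ and let $P_n$ be the path graph with vertices $0,1,\dots,n$ and edges $\{t,t+1\}$. Let $D=D_2(P_n)[X,X]$, where $X$ consists of the $2n-1$ two-element subsets ordered as $\{0,1\},\{0,2\},\dots,\{0,n\},\{1,n\},\{2,n\},\dots,\{n-1,n\}$, i.e. $D$ is the $(2n-1)\times(2n-1)$ matrix whose $(X_1,X_2)$-entry is the Steiner distance $d_{P_n}(X_1\cup X_2)$. Let $L$ be the Laplacian matrix of the path on $2n-1$ vertices $1,\dots,2n-1$ (edges $\{t,t+1\}$), let $u\in\mathbb{R}^{2n-1}$ have $1$ in position $n$ and $0$ elsewhere, and let $\mathbf{1}$ be the all-ones vector in $\mathbb{R}^{2n-1}$. Then \[LD+I=u\mathbf{1}'.\]
   Context: For a connected graph $G$ and a vertex set $Y$ with $|Y|\ge 2$, the Steiner distance $d_G(Y)$ is the minimum number of edges among all connected subgraphs of $G$ whose vertex set contains $Y$. The Laplacian $L$ of a graph has diagonal entries equal to vertex degrees, $-1$ at $(i,j)$ if $i,j$ are adjacent, and $0$ otherwise. $I$ is the identity matrix. -}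

module Defs where

open import Data.Nat as ℕ using (ℕ; zero; suc; _≡ᵇ_; _<ᵇ_; _≤_; _*_; _∸_)
open import Data.Fin using (Fin; toℕ; zero; suc)
open import Data.Bool using (Bool; true; false; _∨_; _∧_; if_then_else_)
open import Data.Integer as ℤ using (ℤ; +_; -_)
open import Data.Product using (Σ; _×_; ∃)
open import Relation.Binary.PropositionalEquality using (_≡_)
open import Relation.Binary.Construct.Closure.ReflexiveTransitive using (Star)

Σℕ : (m : ℕ) → (Fin m → ℕ) → ℕ
Σℕ zero    f = 0
Σℕ (suc m) f = f zero ℕ.+ Σℕ m (λ i → f (suc i))

Σℤ : (m : ℕ) → (Fin m → ℤ) → ℤ
Σℤ zero    f = + 0
Σℤ (suc m) f = f zero ℤ.+ Σℤ m (λ i → f (suc i))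

Graph : ℕ → Set
Graph m = Fin m → Fin m → Bool

pathGraph : (m : ℕ) → Graph m
pathGraph m i j = (suc (toℕ i) ≡ᵇ toℕ j) ∨ (suc (toℕ j) ≡ᵇ toℕ i)

VSet : ℕ → Set
VSet m = Fin m → Bool

_∪_ : ∀ {m} → VSet m → VSet m → VSet m
(A ∪ B) v = A v ∨ B v

_⊆_ : ∀ {m} → VSet m → VSet m → Set
A ⊆ B = ∀ v → A v ≡ true → B v ≡ true

record Subgraph {m : ℕ} (G : Graph m) : Set where
  field
    V     : VSet m
    E     : Fin m → Fin m → Bool
    E-sym : ∀ i j → E i j ≡ true → E j i ≡ true
    E-G   : ∀ i j → E i j ≡ true → G i j ≡ true
    E-V   : ∀ i j → E i j ≡ true → (V i ≡ true × V j ≡ true)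

numEdges : ∀ {m} {G : Graph m} → Subgraph G → ℕ
numEdges {m} H = Σℕ m λ i → Σℕ m λ j →
  if (toℕ i <ᵇ toℕ j) ∧ Subgraph.E H i j then 1 else 0

Connected : ∀ {m} {G : Graph m} → Subgraph G → Set
Connected {m} H = ∀ i j → Subgraph.V H i ≡ true → Subgraph.V H j ≡ true →
  Star (λ a b → Subgraph.E H a b ≡ true) i j

IsSteinerDist : ∀ {m} (G : Graph m) → VSet m → ℕ → Set
IsSteinerDist G Y d =
  (Σ (Subgraph G) λ H → Connected H × (Y ⊆ Subgraph.V H) × numEdges H ≡ d)
  × (∀ (H : Subgraph G) → Connected H → Y ⊆ Subgraph.V H → d ≤ numEdges H)

laplacian : ∀ {m} → Graph m → Fin m → Fin m → ℤ
laplacian {m} G i j =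
  if toℕ i ≡ᵇ toℕ j
  then + (Σℕ m λ k → if G i k then 1 else 0)
  else (if G i j then - (+ 1) else + 0)

-- The index set X of P_n (vertices Fin (suc n)), 0-based index a:
--   a < n   : {0, a+1}
--   a ≥ n   : {a-n+1, n}
Xset : (n : ℕ) → Fin (2 * n ∸ 1) → VSet (suc n)
Xset n a v =
  if toℕ a <ᵇ n
  then (toℕ v ≡ᵇ 0) ∨ (toℕ v ≡ᵇ suc (toℕ a))
  else (toℕ v ≡ᵇ suc (toℕ a ∸ n)) ∨ (toℕ v ≡ᵇ n)

idM : ∀ {m} → Fin m → Fin m → ℤ
idM i j = if toℕ i ≡ᵇ toℕ j then + 1 else + 0

LDplusI : (m : ℕ) → (Fin m → Fin m → ℤ) → (Fin m → Fin m → ℕ) → Fin m → Fin m → ℤ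
LDplusI m L D i j = (Σℤ m λ k → L i k ℤ.* + (D k j)) ℤ.+ idM i j

-- u 1' where u has 1 in (1-based) position n, i.e. 0-based index n-1
u1' : (n : ℕ) → Fin (2 * n ∸ 1) → Fin (2 * n ∸ 1) → ℤ
u1' n i j = if suc (toℕ i) ≡ᵇ n then + 1 else + 0

{-# OPTIONS --safe #-}
-- In a path, a vertex set with least element p and greatest element q has Steiner
-- distance q - p: the subpath from p to q is a connected witness, and every walk from
-- p to q uses each of the q - p edges in between.  The set X_k has endpoints
-- lo k = (k + 1) ∸ n and hi k = min (n , k + 1), both monotone in k, so
-- D(k, j) = hi (max (k , j)) - lo (min (k , j)), and its increment in k is
-- s k = [j ≤ k] - [n ≤ k + 1].  Row i of L D is s (i - 1) - s i, which equals
-- [i + 1 = n] - [i = j]; in the first row this uses n ≥ 1, and in the last row the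
-- missing right neighbour is harmless because s vanishes there.
module Submission where

open import Defs
open import Data.Nat using (ℕ; _≤_; _*_; _∸_; suc)
open import Data.Fin using (Fin)
open import Relation.Binary.PropositionalEquality using (_≡_)

open import Data.Nat as ℕ
  using (zero; _+_; _<_; _⊔_; _⊓_; _≡ᵇ_; _<ᵇ_; _≤ᵇ_; z≤n; s≤s; s≤s⁻¹; _≟_; _<?_; _≤?_)
open import Data.Nat.Properties
open import Data.Fin as Fin using (toℕ; fromℕ<)
open import Data.Fin.Properties using (toℕ-injective; toℕ<n; toℕ-fromℕ<)
open import Data.Bool using (Bool; true; false; _∨_; _∧_; if_then_else_)
open import Data.Integer as ℤ using (ℤ; +_; -_)
import Data.Integer.Properties as ℤ
open import Data.Integer.Tactic.RingSolver using (solve-∀)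
open import Algebra.Properties.Semiring.Sum ℤ.+-*-semiring
  using (sum; ∑-distrib-+; *-distribʳ-sum; sum-cong-≗; sum-replicate-zero)
open import Data.Product using (∃-syntax; _×_; _,_; proj₁)
open import Data.Sum using (_⊎_; inj₁; inj₂; [_,_]′; swap; map)
open import Data.Empty using (⊥-elim)
open import Function using (_∘_)
open import Relation.Nullary using (yes; no)
open import Relation.Nullary.Decidable
  using (Dec; does; proof; map′; _×-dec_; _⊎-dec_; ¬?; dec-true; dec-false)
open import Relation.Nullary.Reflects using (ofʸ; ofⁿ)
open import Relation.Binary.PropositionalEquality
  using (refl; sym; trans; cong; cong₂; subst; subst₂; module ≡-Reasoning)
open import Relation.Binary.Construct.Closure.ReflexiveTransitive using (Star; ε; _◅_; reverse)

-- Iverson brackets and finite sums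

⟦_⟧ : Bool → ℤ
⟦ b ⟧ = if b then + 1 else + 0

⟦<ᵇ-suc⟧ : ∀ a b → ⟦ a <ᵇ suc b ⟧ ≡ ⟦ a <ᵇ b ⟧ ℤ.+ ⟦ b ≡ᵇ a ⟧
⟦<ᵇ-suc⟧ zero    zero    = refl
⟦<ᵇ-suc⟧ zero    (suc b) = refl
⟦<ᵇ-suc⟧ (suc a) zero    = refl
⟦<ᵇ-suc⟧ (suc a) (suc b) = ⟦<ᵇ-suc⟧ a b

⟦≤ᵇ-suc⟧ : ∀ a b → ⟦ a ≤ᵇ suc b ⟧ ≡ ⟦ a ≤ᵇ b ⟧ ℤ.+ ⟦ suc b ≡ᵇ a ⟧
⟦≤ᵇ-suc⟧ zero    b = refl
⟦≤ᵇ-suc⟧ (suc a) b = ⟦<ᵇ-suc⟧ a b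

+-∸ : ∀ {x y} → y ≤ x → + (x ∸ y) ≡ + x ℤ.- + y
+-∸ {x} {y} y≤x = trans (sym (ℤ.≤-⊖ y≤x)) (sym (ℤ.[+m]-[+n]≡m⊖n x y))

dec-true⁻¹ : ∀ {a} {A : Set a} (a? : Dec A) → does a? ≡ true → A
dec-true⁻¹ (yes a) _ = a

-- Decides p ≤ x < q through the Boolean (x <ᵇ q) ∧ not (x <ᵇ p), which reduces
-- when all three arguments are successors.
between? : ∀ p q x → Dec (p ≤ x × x < q)
between? p q x = map′ (λ (x<q , x≮p) → ≮⇒≥ x≮p , x<q) (λ (p≤x , x<q) → x<q , ≤⇒≯ p≤x)
                      ((x <? q) ×-dec ¬? (x <? p))

indicator : Bool → ℕ
indicator b = if b then 1 else 0

indicator≤ : ∀ {a} {A : Set a} (a? : Dec A) {n} → (A → 1 ≤ n) → indicator (does a?) ≤ n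
indicator≤ (yes a) 1≤n = 1≤n a
indicator≤ (no _)  _   = z≤n

Σℕ-zero : ∀ m → Σℕ m (λ _ → 0) ≡ 0
Σℕ-zero zero    = refl
Σℕ-zero (suc m) = Σℕ-zero m

Σℕ-mono : ∀ {m} {f g : Fin m → ℕ} → (∀ k → f k ≤ g k) → Σℕ m f ≤ Σℕ m g
Σℕ-mono {zero}  _   = z≤n
Σℕ-mono {suc m} f≤g = +-mono-≤ (f≤g Fin.zero) (Σℕ-mono (f≤g ∘ Fin.suc))

term≤Σℕ : ∀ {m} (f : Fin m → ℕ) k → f k ≤ Σℕ m f
term≤Σℕ f Fin.zero    = m≤m+n _ _
term≤Σℕ f (Fin.suc k) = ≤-trans (term≤Σℕ (f ∘ Fin.suc) k) (m≤n+m _ _)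

Σℕ-sift : ∀ m c x → Σℕ m (λ k → if c ≡ᵇ toℕ k then x else 0) ≡ (if c <ᵇ m then x else 0)
Σℕ-sift zero    c       x = refl
Σℕ-sift (suc m) zero    x = trans (cong (λ s → x + s) (Σℕ-zero m)) (+-identityʳ x)
Σℕ-sift (suc m) (suc c) x = Σℕ-sift m c x

Σℕ-between : ∀ N p q → q ≤ N → Σℕ N (λ x → indicator (does (between? p q (toℕ x)))) ≡ q ∸ p
Σℕ-between zero    p       zero    z≤n       = sym (0∸n≡0 p)
Σℕ-between (suc N) p       zero    _         = trans (Σℕ-zero (suc N)) (sym (0∸n≡0 p))
Σℕ-between (suc N) zero    (suc q) (s≤s q≤N) = cong suc (Σℕ-between N zero q q≤N)
Σℕ-between (suc N) (suc p) (suc q) (s≤s q≤N) = Σℕ-between N p q q≤N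

Σℤ≡sum : ∀ m (f : Fin m → ℤ) → Σℤ m f ≡ sum f
Σℤ≡sum zero    f = refl
Σℤ≡sum (suc m) f = cong (λ s → f Fin.zero ℤ.+ s) (Σℤ≡sum m (f ∘ Fin.suc))

sum-sift : ∀ m c (h : ℕ → ℤ) → sum {m} (λ k → ⟦ c ≡ᵇ toℕ k ⟧ ℤ.* h (toℕ k)) ≡ ⟦ c <ᵇ m ⟧ ℤ.* h c
sum-sift zero    c       h = refl
sum-sift (suc m) zero    h =
  trans (cong (λ s → + 1 ℤ.* h 0 ℤ.+ s) (sum-replicate-zero m)) (ℤ.+-identityʳ _)
sum-sift (suc m) (suc c) h = trans (ℤ.+-identityˡ _) (sum-sift m c (h ∘ suc))

+Σℕ-indicator : ∀ m (P : Fin m → Bool) → + Σℕ m (indicator ∘ P) ≡ sum (⟦_⟧ ∘ P)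
+Σℕ-indicator zero    P = refl
+Σℕ-indicator (suc m) P =
  trans (ℤ.pos-+ (indicator (P Fin.zero)) _)
        (cong₂ ℤ._+_ (+indicator (P Fin.zero)) (+Σℕ-indicator m (P ∘ Fin.suc)))
  where
  +indicator : ∀ b → + indicator b ≡ ⟦ b ⟧
  +indicator true  = refl
  +indicator false = refl

-- Steiner distance in a path

isSteinerDist-unique : ∀ {m} {G : Graph m} {Y d d′} →
                       IsSteinerDist G Y d → IsSteinerDist G Y d′ → d ≡ d′
isSteinerDist-unique ((H , H-conn , Y⊆H , refl) , H-min) ((H′ , H′-conn , Y⊆H′ , refl) , H′-min) =
  ≤-antisym (H-min H′ H′-conn Y⊆H′) (H′-min H H-conn Y⊆H)

module _ {N : ℕ} where

  Adjacent : Fin N → Fin N → Set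
  Adjacent x y = suc (toℕ x) ≡ toℕ y ⊎ suc (toℕ y) ≡ toℕ x

  adjacent? : ∀ x y → Dec (Adjacent x y)
  adjacent? x y = (suc (toℕ x) ≟ toℕ y) ⊎-dec (suc (toℕ y) ≟ toℕ x)

  pathGraph-irreflexive : ∀ x → pathGraph N x x ≡ false
  pathGraph-irreflexive x = dec-false (adjacent? x x) [ 1+n≢n , 1+n≢n ]′

  Edge : Subgraph (pathGraph N) → Fin N → Fin N → Set
  Edge H x y = Subgraph.E H x y ≡ true

  forwardDegree : Subgraph (pathGraph N) → Fin N → ℕ
  forwardDegree H x = Σℕ N (λ y → indicator ((toℕ x <ᵇ toℕ y) ∧ Subgraph.E H x y))

  walk-crosses : ∀ (H : Subgraph (pathGraph N)) {a b} → Star (Edge H) a b →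
                 ∀ x → toℕ a ≤ toℕ x → toℕ x < toℕ b → ∃[ y ] toℕ y ≡ suc (toℕ x) × Edge H x y
  walk-crosses H ε x a≤x x<a = ⊥-elim (<-irrefl refl (≤-<-trans a≤x x<a))
  walk-crosses H {a} (_◅_ {j = a′} e walk) x a≤x x<b with toℕ a′ ≤? toℕ x
  ... | yes a′≤x = walk-crosses H walk x a′≤x x<b
  ... | no a′≰x with dec-true⁻¹ (adjacent? a a′) (Subgraph.E-G H a a′ e)
  ...   | inj₂ 1+a′≡a = ⊥-elim (a′≰x (<⇒≤ (subst (_≤ toℕ x) (sym 1+a′≡a) a≤x)))
  ...   | inj₁ 1+a≡a′ =
    a′ , trans (sym 1+a≡a′) (cong suc a≡x) , subst (λ v → Edge H v a′) (toℕ-injective a≡x) e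
    where
    a≡x : toℕ a ≡ toℕ x
    a≡x = ≤-antisym a≤x (s≤s⁻¹ (subst (toℕ x <_) (sym 1+a≡a′) (≰⇒> a′≰x)))

  span≤numEdges : ∀ (H : Subgraph (pathGraph N)) → Connected H → ∀ {a b} →
                  Subgraph.V H a ≡ true → Subgraph.V H b ≡ true → toℕ b ∸ toℕ a ≤ numEdges H
  span≤numEdges H H-conn {a} {b} a∈H b∈H = begin
    toℕ b ∸ toℕ a                    ≡⟨ Σℕ-between N (toℕ a) (toℕ b) (<⇒≤ (toℕ<n b)) ⟨
    Σℕ N (λ x → inSpan (toℕ x))      ≤⟨ Σℕ-mono crossing ⟩
    numEdges H                       ∎
    where
    open ≤-Reasoning
    inSpan : ℕ → ℕ
    inSpan x = indicator (does (between? (toℕ a) (toℕ b) x))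
    crossing : ∀ x → inSpan (toℕ x) ≤ forwardDegree H x
    crossing x = indicator≤ (between? (toℕ a) (toℕ b) (toℕ x)) λ (a≤x , x<b) →
      let (y , y≡1+x , e) = walk-crosses H (H-conn a b a∈H b∈H) x a≤x x<b
          term≡1 : indicator ((toℕ x <ᵇ toℕ y) ∧ Subgraph.E H x y) ≡ 1
          term≡1 = cong₂ (λ b c → indicator (b ∧ c))
                         (dec-true (toℕ x <? toℕ y) (≤-reflexive (sym y≡1+x))) e
      in ≤-trans (≤-reflexive (sym term≡1)) (term≤Σℕ _ y)

  module _ (p q : Fin N) where

    InInterval : Fin N → Set
    InInterval v = toℕ p ≤ toℕ v × toℕ v < suc (toℕ q)

    inInterval? : ∀ v → Dec (InInterval v)
    inInterval? v = between? (toℕ p) (suc (toℕ q)) (toℕ v)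

    intervalEdge? : ∀ x y → Dec (Adjacent x y × InInterval x × InInterval y)
    intervalEdge? x y = adjacent? x y ×-dec inInterval? x ×-dec inInterval? y

    interval : Subgraph (pathGraph N)
    interval = record
      { V     = does ∘ inInterval?
      ; E     = λ x y → does (intervalEdge? x y)
      ; E-sym = λ x y e → let (xy , x∈ , y∈) = dec-true⁻¹ (intervalEdge? x y) e
                          in dec-true (intervalEdge? y x) (swap xy , y∈ , x∈)
      ; E-G   = λ x y e → dec-true (adjacent? x y) (proj₁ (dec-true⁻¹ (intervalEdge? x y) e))
      ; E-V   = λ x y e → let (_ , x∈ , y∈) = dec-true⁻¹ (intervalEdge? x y) e
                          in dec-true (inInterval? x) x∈ , dec-true (inInterval? y) y∈
      }

    interval-climb : ∀ k {a b} → toℕ b ≡ k + toℕ a → InInterval a → InInterval b →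
                     Star (Edge interval) a b
    interval-climb zero    {a} b≡a _ _ = subst (Star (Edge interval) a) (toℕ-injective (sym b≡a)) ε
    interval-climb (suc k) {a} {b} b≡1+k+a a∈@(p≤a , _) b∈@(_ , b<1+q) =
      dec-true (intervalEdge? a a′) (inj₁ (sym a′≡1+a) , a∈ , a′∈) ◅ interval-climb k b≡k+a′ a′∈ b∈
      where
      1+a≤b : suc (toℕ a) ≤ toℕ b
      1+a≤b = subst (suc (toℕ a) ≤_) (sym b≡1+k+a) (s≤s (m≤n+m (toℕ a) k))
      a′ : Fin N
      a′ = fromℕ< (≤-<-trans 1+a≤b (toℕ<n b))
      a′≡1+a : toℕ a′ ≡ suc (toℕ a)
      a′≡1+a = toℕ-fromℕ< _
      a′∈ : InInterval a′
      a′∈ = subst (λ t → toℕ p ≤ t × t < suc (toℕ q)) (sym a′≡1+a)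
                  (≤-trans p≤a (n≤1+n _) , ≤-<-trans 1+a≤b b<1+q)
      b≡k+a′ : toℕ b ≡ k + toℕ a′
      b≡k+a′ = trans b≡1+k+a (trans (sym (+-suc k (toℕ a))) (cong (λ t → k + t) (sym a′≡1+a)))

    inInterval : ∀ {v} → does (inInterval? v) ≡ true → InInterval v
    inInterval = dec-true⁻¹ (inInterval? _)

    interval-connected : Connected interval
    interval-connected a b a∈ b∈ with ≤-total (toℕ a) (toℕ b)
    ... | inj₁ a≤b = interval-climb (toℕ b ∸ toℕ a) (sym (m∸n+n≡m a≤b)) (inInterval a∈) (inInterval b∈)
    ... | inj₂ b≤a = reverse (λ {x} {y} → Subgraph.E-sym interval x y)
                       (interval-climb (toℕ a ∸ toℕ b) (sym (m∸n+n≡m b≤a)) (inInterval b∈) (inInterval a∈))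

    numEdges-interval : numEdges interval ≤ toℕ q ∸ toℕ p
    numEdges-interval = begin
      numEdges interval            ≤⟨ Σℕ-mono forwardDegree≤ ⟩
      Σℕ N (λ x → inSpan (toℕ x))  ≡⟨ Σℕ-between N (toℕ p) (toℕ q) (<⇒≤ (toℕ<n q)) ⟩
      toℕ q ∸ toℕ p                ∎
      where
      open ≤-Reasoning
      inSpan : ℕ → ℕ
      inSpan x = indicator (does (between? (toℕ p) (toℕ q) x))

      term≤ : ∀ x y → indicator ((toℕ x <ᵇ toℕ y) ∧ Subgraph.E interval x y)
                      ≤ (if suc (toℕ x) ≡ᵇ toℕ y then inSpan (toℕ x) else 0)
      term≤ x y = indicator≤ ((toℕ x <? toℕ y) ×-dec intervalEdge? x y) λ where
        (x<y , inj₂ 1+y≡x , _) → ⊥-elim (<-asym x<y (subst (toℕ y <_) 1+y≡x ≤-refl))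
        (x<y , inj₁ 1+x≡y , (p≤x , _) , (_ , y<1+q)) →
          ≤-reflexive (sym (cong₂ (λ b c → if b then indicator c else 0)
            (dec-true (suc (toℕ x) ≟ toℕ y) 1+x≡y)
            (dec-true (between? (toℕ p) (toℕ q) (toℕ x))
                      (p≤x , s≤s⁻¹ (subst (_< suc (toℕ q)) (sym 1+x≡y) y<1+q)))))

      forwardDegree≤ : ∀ x → forwardDegree interval x ≤ inSpan (toℕ x)
      forwardDegree≤ x = begin
        forwardDegree interval x                                     ≤⟨ Σℕ-mono (term≤ x) ⟩
        Σℕ N (λ y → if suc (toℕ x) ≡ᵇ toℕ y then inSpan (toℕ x) else 0) ≡⟨ Σℕ-sift N (suc (toℕ x)) _ ⟩
        (if suc (toℕ x) <ᵇ N then inSpan (toℕ x) else 0)              ≤⟨ if≤ (suc (toℕ x) <ᵇ N) ⟩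
        inSpan (toℕ x)                                               ∎
        where
        if≤ : ∀ b → (if b then inSpan (toℕ x) else 0) ≤ inSpan (toℕ x)
        if≤ true  = ≤-refl
        if≤ false = z≤n

  path-isSteinerDist : ∀ {Y : VSet N} {p q : Fin N} → Y p ≡ true → Y q ≡ true →
                       (∀ v → Y v ≡ true → toℕ p ≤ toℕ v × toℕ v ≤ toℕ q) →
                       IsSteinerDist (pathGraph N) Y (toℕ q ∸ toℕ p)
  path-isSteinerDist {Y} {p} {q} p∈Y q∈Y Y⊆[p,q] =
    ( interval p q , interval-connected p q , Y⊆I
    , ≤-antisym (numEdges-interval p q) (lower (interval p q) (interval-connected p q) Y⊆I) )
    , lower
    where
    Y⊆I : Y ⊆ Subgraph.V (interval p q)
    Y⊆I v v∈Y = let (p≤v , v≤q) = Y⊆[p,q] v v∈Y in dec-true (inInterval? p q v) (p≤v , s≤s v≤q)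
    lower : ∀ H → Connected H → Y ⊆ Subgraph.V H → toℕ q ∸ toℕ p ≤ numEdges H
    lower H H-conn Y⊆H = span≤numEdges H H-conn (Y⊆H p p∈Y) (Y⊆H q q∈Y)

-- Laplacian of a path

laplacian-row : ∀ {m} (G : Graph m) → (∀ x → G x x ≡ false) → ∀ i (g : Fin m → ℤ) →
                sum (λ k → laplacian G i k ℤ.* g k) ≡ sum (λ k → ⟦ G i k ⟧ ℤ.* (g i ℤ.- g k))
laplacian-row {m} G irreflexive i g = begin
  sum (λ k → laplacian G i k ℤ.* g k)               ≡⟨ sum-cong-≗ entry ⟩
  sum (λ k → diagonal k ℤ.+ offDiagonal k)          ≡⟨ ∑-distrib-+ diagonal offDiagonal ⟩
  sum diagonal ℤ.+ sum offDiagonal                  ≡⟨ cong (ℤ._+ sum offDiagonal) sum-diagonal ⟩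
  sum (λ k → ⟦ G i k ⟧ ℤ.* g i) ℤ.+ sum offDiagonal ≡⟨ ∑-distrib-+ (λ k → ⟦ G i k ⟧ ℤ.* g i) offDiagonal ⟨
  sum (λ k → ⟦ G i k ⟧ ℤ.* g i ℤ.+ offDiagonal k)   ≡⟨ sum-cong-≗ (λ k → ℤ.*-distribˡ-+ ⟦ G i k ⟧ (g i) (- g k)) ⟨
  sum (λ k → ⟦ G i k ⟧ ℤ.* (g i ℤ.- g k))           ∎
  where
  open ≡-Reasoning
  degree : ℕ
  degree = Σℕ m (indicator ∘ G i)

  diagonal offDiagonal : Fin m → ℤ
  diagonal k    = ⟦ toℕ i ≡ᵇ toℕ k ⟧ ℤ.* (+ degree ℤ.* g i)
  offDiagonal k = ⟦ G i k ⟧ ℤ.* - g k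

  entry : ∀ k → laplacian G i k ℤ.* g k ≡ diagonal k ℤ.+ offDiagonal k
  entry k with toℕ i ≡ᵇ toℕ k | proof (toℕ i ≟ toℕ k)
  ... | true  | ofʸ i≡k rewrite toℕ-injective i≡k | irreflexive k =
    sym (trans (ℤ.+-identityʳ _) (ℤ.*-identityˡ _))
  ... | false | ofⁿ _ with G i k
  ...   | true  = trans (ℤ.-1*i≡-i (g k)) (sym (trans (ℤ.+-identityˡ _) (ℤ.*-identityˡ _)))
  ...   | false = refl

  sum-diagonal : sum diagonal ≡ sum (λ k → ⟦ G i k ⟧ ℤ.* g i)
  sum-diagonal = begin
    sum diagonal                          ≡⟨ sum-sift m (toℕ i) (λ _ → + degree ℤ.* g i) ⟩
    ⟦ toℕ i <ᵇ m ⟧ ℤ.* (+ degree ℤ.* g i) ≡⟨ cong (λ b → ⟦ b ⟧ ℤ.* (+ degree ℤ.* g i))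
                                                  (dec-true (toℕ i <? m) (toℕ<n i)) ⟩
    + 1 ℤ.* (+ degree ℤ.* g i)            ≡⟨ ℤ.*-identityˡ _ ⟩
    + degree ℤ.* g i                      ≡⟨ cong (ℤ._* g i) (+Σℕ-indicator m (G i)) ⟩
    sum (λ k → ⟦ G i k ⟧) ℤ.* g i         ≡⟨ *-distribʳ-sum (g i) (⟦_⟧ ∘ G i) ⟩
    sum (λ k → ⟦ G i k ⟧ ℤ.* g i)         ∎

⟦pathGraph⟧ : ∀ a b → ⟦ (suc a ≡ᵇ b) ∨ (suc b ≡ᵇ a) ⟧ ≡ ⟦ suc a ≡ᵇ b ⟧ ℤ.+ ⟦ a ≡ᵇ suc b ⟧
⟦pathGraph⟧ zero          zero          = refl
⟦pathGraph⟧ zero          (suc zero)    = refl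
⟦pathGraph⟧ zero          (suc (suc b)) = refl
⟦pathGraph⟧ (suc zero)    zero          = refl
⟦pathGraph⟧ (suc (suc a)) zero          = refl
⟦pathGraph⟧ (suc a)       (suc b)       = ⟦pathGraph⟧ a b

leftDiff : (ℕ → ℤ) → ℕ → ℤ
leftDiff g zero    = + 0
leftDiff g (suc x) = g (suc x) ℤ.- g x

sum-sift-predecessor : ∀ {m} (i : Fin m) (g : ℕ → ℤ) →
  sum {m} (λ k → ⟦ toℕ i ≡ᵇ suc (toℕ k) ⟧ ℤ.* (g (toℕ i) ℤ.- g (toℕ k))) ≡ leftDiff g (toℕ i)
sum-sift-predecessor {suc m} Fin.zero    g = sum-replicate-zero (suc m)
sum-sift-predecessor {suc m} (Fin.suc i) g = begin
  sum {suc m} (λ k → ⟦ toℕ i ≡ᵇ toℕ k ⟧ ℤ.* h (toℕ k)) ≡⟨ sum-sift (suc m) (toℕ i) h ⟩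
  ⟦ toℕ i <ᵇ suc m ⟧ ℤ.* h (toℕ i)                     ≡⟨ cong (λ b → ⟦ b ⟧ ℤ.* h (toℕ i))
                                                              (dec-true (toℕ i <? suc m) (m<n⇒m<1+n (toℕ<n i))) ⟩
  + 1 ℤ.* h (toℕ i)                                    ≡⟨ ℤ.*-identityˡ _ ⟩
  h (toℕ i)                                            ∎
  where
  open ≡-Reasoning
  h : ℕ → ℤ
  h t = g (suc (toℕ i)) ℤ.- g t

pathLaplacian-row : ∀ {m} (i : Fin m) (g : ℕ → ℤ) →
  sum (λ k → laplacian (pathGraph m) i k ℤ.* g (toℕ k))
  ≡ ⟦ suc (toℕ i) <ᵇ m ⟧ ℤ.* (g (toℕ i) ℤ.- g (suc (toℕ i))) ℤ.+ leftDiff g (toℕ i)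
pathLaplacian-row {m} i g = begin
  sum (λ k → laplacian (pathGraph m) i k ℤ.* g (toℕ k))
    ≡⟨ laplacian-row (pathGraph m) pathGraph-irreflexive i (g ∘ toℕ) ⟩
  sum (λ k → ⟦ pathGraph m i k ⟧ ℤ.* h (toℕ k))
    ≡⟨ sum-cong-≗ split ⟩
  sum (λ k → next k ℤ.+ previous k)
    ≡⟨ ∑-distrib-+ next previous ⟩
  sum next ℤ.+ sum previous
    ≡⟨ cong₂ ℤ._+_ (sum-sift m (suc (toℕ i)) h) (sum-sift-predecessor i g) ⟩
  ⟦ suc (toℕ i) <ᵇ m ⟧ ℤ.* h (suc (toℕ i)) ℤ.+ leftDiff g (toℕ i) ∎
  where
  open ≡-Reasoning
  h : ℕ → ℤ
  h t = g (toℕ i) ℤ.- g t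
  next previous : Fin m → ℤ
  next k     = ⟦ suc (toℕ i) ≡ᵇ toℕ k ⟧ ℤ.* h (toℕ k)
  previous k = ⟦ toℕ i ≡ᵇ suc (toℕ k) ⟧ ℤ.* h (toℕ k)
  split : ∀ k → ⟦ pathGraph m i k ⟧ ℤ.* h (toℕ k) ≡ next k ℤ.+ previous k
  split k = trans (cong (ℤ._* h (toℕ k)) (⟦pathGraph⟧ (toℕ i) (toℕ k)))
                  (ℤ.*-distribʳ-+ (h (toℕ k)) ⟦ suc (toℕ i) ≡ᵇ toℕ k ⟧ ⟦ toℕ i ≡ᵇ suc (toℕ k) ⟧)

-- The matrix D

-- D(k + 1, j) - D(k, j), for 0-based indices k, j (see column-suc).
columnStep : ℕ → ℕ → ℕ → ℤ
columnStep n j k = ⟦ j ≤ᵇ k ⟧ ℤ.- ⟦ n ≤ᵇ suc k ⟧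

previousStep : ℕ → ℕ → ℕ → ℤ
previousStep n j zero    = + 0
previousStep n j (suc k) = columnStep n j k

columnStep-jump : ∀ {n} → 1 ≤ n → ∀ j i →
  ℤ.- columnStep n j i ℤ.+ previousStep n j i ℤ.+ ⟦ i ≡ᵇ j ⟧ ≡ ⟦ suc i ≡ᵇ n ⟧
columnStep-jump {suc zero}    _ zero    zero    = refl
columnStep-jump {suc zero}    _ (suc j) zero    = refl
columnStep-jump {suc (suc n)} _ zero    zero    = refl
columnStep-jump {suc (suc n)} _ (suc j) zero    = refl
columnStep-jump {n}           _ j       (suc i) = begin
  ℤ.- columnStep n j (suc i) ℤ.+ columnStep n j i ℤ.+ ⟦ suc i ≡ᵇ j ⟧
    ≡⟨ cong₂ (λ a b → ℤ.- (a ℤ.- b) ℤ.+ columnStep n j i ℤ.+ ⟦ suc i ≡ᵇ j ⟧)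
             (⟦≤ᵇ-suc⟧ j i) (⟦≤ᵇ-suc⟧ n (suc i)) ⟩
  ℤ.- ((⟦ j ≤ᵇ i ⟧ ℤ.+ ⟦ suc i ≡ᵇ j ⟧) ℤ.- (⟦ n ≤ᵇ suc i ⟧ ℤ.+ ⟦ suc (suc i) ≡ᵇ n ⟧))
    ℤ.+ (⟦ j ≤ᵇ i ⟧ ℤ.- ⟦ n ≤ᵇ suc i ⟧) ℤ.+ ⟦ suc i ≡ᵇ j ⟧
    ≡⟨ cancel ⟦ j ≤ᵇ i ⟧ ⟦ suc i ≡ᵇ j ⟧ ⟦ n ≤ᵇ suc i ⟧ ⟦ suc (suc i) ≡ᵇ n ⟧ ⟩
  ⟦ suc (suc i) ≡ᵇ n ⟧ ∎
  where
  open ≡-Reasoning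
  cancel : ∀ a c b e → ℤ.- ((a ℤ.+ c) ℤ.- (b ℤ.+ e)) ℤ.+ (a ℤ.- b) ℤ.+ c ≡ e
  cancel = solve-∀

n≤2n∸1 : ∀ {n} → 1 ≤ n → n ≤ 2 * n ∸ 1
n≤2n∸1 {suc n} _ = subst (_≤ n + (suc n + 0)) (+-identityʳ (suc n)) (m≤n+m (suc n + 0) n)

module _ (n : ℕ) where

  lo hi : ℕ → ℕ
  lo a = suc a ∸ n
  hi a = n ⊓ suc a

  Xset≡ : ∀ a v → Xset n a v ≡ (toℕ v ≡ᵇ lo (toℕ a)) ∨ (toℕ v ≡ᵇ hi (toℕ a))
  Xset≡ a v with toℕ a <ᵇ n | proof (toℕ a <? n)
  ... | true  | ofʸ a<n = cong₂ (λ l h → (toℕ v ≡ᵇ l) ∨ (toℕ v ≡ᵇ h))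
                                (sym (m≤n⇒m∸n≡0 a<n)) (sym (m≥n⇒m⊓n≡n a<n))
  ... | false | ofⁿ a≮n = cong₂ (λ l h → (toℕ v ≡ᵇ l) ∨ (toℕ v ≡ᵇ h))
                                (sym (+-∸-assoc 1 (≮⇒≥ a≮n)))
                                (sym (m≤n⇒m⊓n≡m (m≤n⇒m≤1+n (≮⇒≥ a≮n))))

  1+index≤n+n : ∀ (a : Fin (2 * n ∸ 1)) → suc (toℕ a) ≤ n + n
  1+index≤n+n a = ≤-trans (toℕ<n a)
                          (≤-trans (m∸n≤m (2 * n) 1) (≤-reflexive (cong (λ t → n + t) (+-identityʳ n))))

  lo≤hi : ∀ {a} → suc a ≤ n + n → lo a ≤ hi a
  lo≤hi {a} 1+a≤n+n = ⊓-glb (≤-trans (∸-monoˡ-≤ n 1+a≤n+n) (≤-reflexive (m+n∸n≡m n n)))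
                            (m∸n≤m (suc a) n)

  Xset-steinerDist : ∀ (a b : Fin (2 * n ∸ 1)) {d} →
                     IsSteinerDist (pathGraph (suc n)) (Xset n a ∪ Xset n b) d →
                     d ≡ hi (toℕ a ⊔ toℕ b) ∸ lo (toℕ a ⊓ toℕ b)
  Xset-steinerDist a b {d} isD = begin
    d                                 ≡⟨ isSteinerDist-unique isD (path-isSteinerDist p∈Y q∈Y Y⊆[p,q]) ⟩
    toℕ q ∸ toℕ p                     ≡⟨ cong₂ _∸_ (toℕ-fromℕ< q<1+n) (toℕ-fromℕ< p<1+n) ⟩
    (hi a′ ⊔ hi b′) ∸ (lo a′ ⊓ lo b′) ≡⟨ cong₂ _∸_ (⊓-distribˡ-⊔ n (suc a′) (suc b′))
                                                   (∸-distribʳ-⊓ n (suc a′) (suc b′)) ⟨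
    hi (a′ ⊔ b′) ∸ lo (a′ ⊓ b′)       ∎
    where
    open ≡-Reasoning
    a′ b′ : ℕ
    a′ = toℕ a
    b′ = toℕ b
    la≤ha : lo a′ ≤ hi a′
    la≤ha = lo≤hi (1+index≤n+n a)
    lb≤hb : lo b′ ≤ hi b′
    lb≤hb = lo≤hi (1+index≤n+n b)

    q<1+n : hi a′ ⊔ hi b′ < suc n
    q<1+n = s≤s (⊔-lub (m⊓n≤m n _) (m⊓n≤m n _))
    p<1+n : lo a′ ⊓ lo b′ < suc n
    p<1+n = ≤-<-trans (≤-trans (m⊓n≤m _ _) (≤-trans la≤ha (m≤m⊔n _ _))) q<1+n
    p q : Fin (suc n)
    p = fromℕ< p<1+n
    q = fromℕ< q<1+n

    Member : ℕ → Set
    Member x = (x ≡ lo a′ ⊎ x ≡ hi a′) ⊎ (x ≡ lo b′ ⊎ x ≡ hi b′)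
    member? : ∀ x → Dec (Member x)
    member? x = ((x ≟ lo a′) ⊎-dec (x ≟ hi a′)) ⊎-dec ((x ≟ lo b′) ⊎-dec (x ≟ hi b′))
    Y≡ : ∀ v → (Xset n a ∪ Xset n b) v ≡ does (member? (toℕ v))
    Y≡ v = cong₂ _∨_ (Xset≡ a v) (Xset≡ b v)

    p∈Y : (Xset n a ∪ Xset n b) p ≡ true
    p∈Y = trans (Y≡ p) (dec-true (member? (toℕ p))
            (map (inj₁ ∘ trans (toℕ-fromℕ< p<1+n)) (inj₁ ∘ trans (toℕ-fromℕ< p<1+n))
                 (⊓-sel (lo a′) (lo b′))))
    q∈Y : (Xset n a ∪ Xset n b) q ≡ true
    q∈Y = trans (Y≡ q) (dec-true (member? (toℕ q))
            (map (inj₂ ∘ trans (toℕ-fromℕ< q<1+n)) (inj₂ ∘ trans (toℕ-fromℕ< q<1+n))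
                 (⊔-sel (hi a′) (hi b′))))

    bounds : ∀ {x} → Member x → lo a′ ⊓ lo b′ ≤ x × x ≤ hi a′ ⊔ hi b′
    bounds (inj₁ (inj₁ refl)) = m⊓n≤m _ _ , ≤-trans la≤ha (m≤m⊔n _ _)
    bounds (inj₁ (inj₂ refl)) = ≤-trans (m⊓n≤m _ _) la≤ha , m≤m⊔n _ _
    bounds (inj₂ (inj₁ refl)) = m⊓n≤n _ _ , ≤-trans lb≤hb (m≤n⊔m _ _)
    bounds (inj₂ (inj₂ refl)) = ≤-trans (m⊓n≤n _ _) lb≤hb , m≤n⊔m _ _
    Y⊆[p,q] : ∀ v → (Xset n a ∪ Xset n b) v ≡ true → toℕ p ≤ toℕ v × toℕ v ≤ toℕ q
    Y⊆[p,q] v v∈Y =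
      subst₂ (λ s t → s ≤ toℕ v × toℕ v ≤ t) (sym (toℕ-fromℕ< p<1+n)) (sym (toℕ-fromℕ< q<1+n))
             (bounds (dec-true⁻¹ (member? (toℕ v)) (trans (sym (Y≡ v)) v∈Y)))

  column : ℕ → ℕ → ℤ
  column j k = + hi (k ⊔ j) ℤ.- + lo (k ⊓ j)

  +D≡column : ∀ (k j : Fin (2 * n ∸ 1)) {d} →
              IsSteinerDist (pathGraph (suc n)) (Xset n k ∪ Xset n j) d → + d ≡ column (toℕ j) (toℕ k)
  +D≡column k j isD = trans (cong +_ (Xset-steinerDist k j isD)) (+-∸ lo≤hi′)
    where
    lo≤hi′ : lo (toℕ k ⊓ toℕ j) ≤ hi (toℕ k ⊔ toℕ j)
    lo≤hi′ = ≤-trans (∸-monoˡ-≤ n (s≤s (m⊓n≤m _ _)))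
                     (≤-trans (lo≤hi (1+index≤n+n k)) (⊓-monoʳ-≤ n (s≤s (m≤m⊔n _ _))))

  lo-suc : ∀ x → + lo (suc x) ≡ + lo x ℤ.+ ⟦ n ≤ᵇ suc x ⟧
  lo-suc x with n ≤ᵇ suc x | proof (n ≤? suc x)
  ... | true  | ofʸ n≤1+x = cong +_ (trans (+-∸-assoc 1 n≤1+x) (+-comm 1 (suc x ∸ n)))
  ... | false | ofⁿ n≰1+x = cong +_ (trans (m≤n⇒m∸n≡0 1+x<n)
                                           (sym (trans (+-identityʳ _) (m≤n⇒m∸n≡0 (<⇒≤ 1+x<n)))))
    where
    1+x<n : suc x < n
    1+x<n = ≰⇒> n≰1+x

  hi-suc : ∀ x → + hi (suc x) ≡ + hi x ℤ.+ (+ 1 ℤ.- ⟦ n ≤ᵇ suc x ⟧)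
  hi-suc x with n ≤ᵇ suc x | proof (n ≤? suc x)
  ... | true  | ofʸ n≤1+x = cong +_ (trans (m≤n⇒m⊓n≡m (m≤n⇒m≤1+n n≤1+x))
                                           (sym (trans (+-identityʳ _) (m≤n⇒m⊓n≡m n≤1+x))))
  ... | false | ofⁿ n≰1+x = cong +_ (trans (m≥n⇒m⊓n≡n 1+x<n)
                                           (trans (+-comm 1 (suc x))
                                                  (cong (λ t → t + 1) (sym (m≥n⇒m⊓n≡n (<⇒≤ 1+x<n))))))
    where
    1+x<n : suc x < n
    1+x<n = ≰⇒> n≰1+x

  column-suc : ∀ j k → column j (suc k) ≡ column j k ℤ.+ columnStep n j k
  column-suc j k with j ≤ᵇ k | proof (j ≤? k)
  ... | true  | ofʸ j≤k
    rewrite m≥n⇒m⊔n≡m j≤k | m≥n⇒m⊔n≡m (m≤n⇒m≤1+n j≤k) | m≥n⇒m⊓n≡n j≤k | m≥n⇒m⊓n≡n (m≤n⇒m≤1+n j≤k)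
    = trans (cong (λ t → t ℤ.- + lo j) (hi-suc k)) (reorder (+ hi k) (+ lo j) (+ 1 ℤ.- ⟦ n ≤ᵇ suc k ⟧))
    where
    reorder : ∀ h l s → h ℤ.+ s ℤ.- l ≡ h ℤ.- l ℤ.+ s
    reorder = solve-∀
  ... | false | ofⁿ j≰k
    rewrite m≤n⇒m⊔n≡n (≰⇒> j≰k) | m≤n⇒m⊔n≡n (<⇒≤ (≰⇒> j≰k)) | m≤n⇒m⊓n≡m (≰⇒> j≰k) | m≤n⇒m⊓n≡m (<⇒≤ (≰⇒> j≰k))
    = trans (cong (λ t → + hi j ℤ.- t) (lo-suc k)) (reorder (+ hi j) (+ lo k) ⟦ n ≤ᵇ suc k ⟧)
    where
    reorder : ∀ h l s → h ℤ.- (l ℤ.+ s) ≡ h ℤ.- l ℤ.+ (+ 0 ℤ.- s)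
    reorder = solve-∀

  column-rowIdentity : 1 ≤ n → ∀ {i j} → i < 2 * n ∸ 1 → j < 2 * n ∸ 1 →
    ⟦ suc i <ᵇ 2 * n ∸ 1 ⟧ ℤ.* (column j i ℤ.- column j (suc i)) ℤ.+ leftDiff (column j) i ℤ.+ ⟦ i ≡ᵇ j ⟧
    ≡ ⟦ suc i ≡ᵇ n ⟧
  column-rowIdentity 1≤n {i} {j} i<m j<m = begin
    ⟦ suc i <ᵇ 2 * n ∸ 1 ⟧ ℤ.* (column j i ℤ.- column j (suc i)) ℤ.+ leftDiff (column j) i ℤ.+ ⟦ i ≡ᵇ j ⟧
      ≡⟨ cong₂ (λ a b → a ℤ.+ b ℤ.+ ⟦ i ≡ᵇ j ⟧) forward (backward i) ⟩
    ℤ.- columnStep n j i ℤ.+ previousStep n j i ℤ.+ ⟦ i ≡ᵇ j ⟧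
      ≡⟨ columnStep-jump 1≤n j i ⟩
    ⟦ suc i ≡ᵇ n ⟧ ∎
    where
    open ≡-Reasoning
    backward : ∀ i → leftDiff (column j) i ≡ previousStep n j i
    backward zero    = refl
    backward (suc i) = trans (cong (λ t → t ℤ.- column j i) (column-suc j i))
                             (cancel (column j i) (columnStep n j i))
      where
      cancel : ∀ c s → c ℤ.+ s ℤ.- c ≡ s
      cancel = solve-∀

    -- The last row of L has no right neighbour, but there the column is flat.
    forward : ⟦ suc i <ᵇ 2 * n ∸ 1 ⟧ ℤ.* (column j i ℤ.- column j (suc i)) ≡ ℤ.- columnStep n j i
    forward with suc i <ᵇ 2 * n ∸ 1 | proof (suc i <? 2 * n ∸ 1)
    ... | true  | ofʸ _ = trans (cong (λ t → + 1 ℤ.* (column j i ℤ.- t)) (column-suc j i))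
                                (cancel (column j i) (columnStep n j i))
      where
      cancel : ∀ c s → + 1 ℤ.* (c ℤ.- (c ℤ.+ s)) ≡ ℤ.- s
      cancel = solve-∀
    ... | false | ofⁿ 1+i≮m = sym (cong ℤ.-_ flat)
      where
      1+i≡m : suc i ≡ 2 * n ∸ 1
      1+i≡m = ≤-antisym i<m (≮⇒≥ 1+i≮m)
      flat : columnStep n j i ≡ + 0
      flat = cong₂ (λ a b → ⟦ a ⟧ ℤ.- ⟦ b ⟧)
               (dec-true (j ≤? i) (s≤s⁻¹ (subst (j <_) (sym 1+i≡m) j<m)))
               (dec-true (n ≤? suc i) (subst (n ≤_) (sym 1+i≡m) (n≤2n∸1 1≤n)))

mainTheorem3 : (n : ℕ) → 1 ≤ n →
    (D : Fin (2 * n ∸ 1) → Fin (2 * n ∸ 1) → ℕ) →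
    (∀ a b → IsSteinerDist (pathGraph (suc n)) (Xset n a ∪ Xset n b) (D a b)) →
    ∀ i j → LDplusI (2 * n ∸ 1) (laplacian (pathGraph (2 * n ∸ 1))) D i j ≡ u1' n i j
mainTheorem3 n 1≤n D isD i j = begin
  Σℤ m (λ k → L i k ℤ.* + D k j) ℤ.+ δ
    ≡⟨ cong (ℤ._+ δ) (Σℤ≡sum m _) ⟩
  sum (λ k → L i k ℤ.* + D k j) ℤ.+ δ
    ≡⟨ cong (ℤ._+ δ) (sum-cong-≗ λ k → cong (L i k ℤ.*_) (+D≡column n k j (isD k j))) ⟩
  sum (λ k → L i k ℤ.* g (toℕ k)) ℤ.+ δ
    ≡⟨ cong (ℤ._+ δ) (pathLaplacian-row i g) ⟩
  ⟦ suc (toℕ i) <ᵇ m ⟧ ℤ.* (g (toℕ i) ℤ.- g (suc (toℕ i))) ℤ.+ leftDiff g (toℕ i) ℤ.+ δ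
    ≡⟨ column-rowIdentity n 1≤n (toℕ<n i) (toℕ<n j) ⟩
  ⟦ suc (toℕ i) ≡ᵇ n ⟧ ∎
  where
  open ≡-Reasoning
  m : ℕ
  m = 2 * n ∸ 1
  L : Fin m → Fin m → ℤ
  L = laplacian (pathGraph m)
  g : ℕ → ℤ
  g = column n (toℕ j)
  δ : ℤ
  δ = ⟦ toℕ i ≡ᵇ toℕ j ⟧
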